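{- Let $G$ and $H$ be finite simple connected graphs and let $K\in\{G,H\}$, with $\bar K$ the other graph. Let $c$ be a configuration on $G\,\square\,H$ whose total $K$-set count satisfies $\sum_{j\in V(\bar K)} set_{K,j}\ \ge\ \pi(\bar K)$. Then $c$ is solvable, i.e. for every root vertex $r$ of $G\,\square\,H$ there is a sequence of pebbling moves starting from $c$ that places at least one pebble on $r$.
   Context: The Cartesian product $G\,\square\,H$ has vertex set $V(G)\times V(H)$, with $(g,h)\sim(g',h')$ iff ($g=g'$ and $h\sim_H h'$) or ($h=h'$ and $g\sim_G g'$). A configuration on a graph $X$ is a function $c:V(X)\to\mathbb{Z}_{\ge 0}$ (number of pebbles on each vertex); its size is $\sum_v c(v)$. A pebbling move removes two pebbles from one vertex and adds one pebble to an adjacent vertex. The pebbling number $\pi(X)$ is the least $k$ such that from every configuration of size $k$ on $X$ and every root $r\in V(X)$ some sequence of pebbling moves places a pebble on $r$. For $K\in\{G,H\}$, $\bar K$ denotes the other graph. For $j\in V(\bar K)$, the $K$-slice $K_j$ is $\{(i,j): i\in V(G)\}$ if $K=G$ (and $j\in V(H)$), and $\{(j,h): h\in V(H)\}$ if $K=H$ (and $j\in V(G)$); it induces a copy of $K$. For a configuration $c$ on $G\,\square\,H$, $\tilde c_{K,j}=\sum_{u\in K_j}c(u)$ and $set_{K,j}=\lfloor \tilde c_{K,j}/\pi(K)\rfloor$ (the number of "$K$-sets" in slice $K_j$); the total $K$-set count is $\sum_{j\in V(\bar K)} set_{K,j}$. -}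

module Defs where

open import Data.Nat using (ℕ; zero; suc; _+_; _*_; _∸_; _≤_; _/_)
open import Data.Fin using (Fin; remQuot; combine)
open import Data.Vec using (sum; tabulate)
open import Data.Product using (Σ; _×_; _,_; proj₁; proj₂)
open import Data.Sum using (_⊎_)
open import Data.Empty using (⊥)
open import Relation.Nullary using (¬_; yes; no)
open import Relation.Binary.PropositionalEquality using (_≡_)
open import Relation.Binary.Construct.Closure.ReflexiveTransitive using (Star)
open import Data.Fin using (_≟_)

record Graph : Set₁ where
  field
    n   : ℕ
    _~_ : Fin n → Fin n → Set
open Graph public

-- simple: adjacency symmetric and irreflexive (no loops); multi-edges
-- are impossible since adjacency is a relation.
record Simple (X : Graph) : Set where
  field
    sym   : ∀ {u v} → _~_ X u v → _~_ X v u
    irrefl : ∀ {u} → ¬ (_~_ X u u)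

Connected : Graph → Set
Connected X = ∀ (u v : Fin (n X)) → Star (_~_ X) u v

ΣFin : ∀ {k} → (Fin k → ℕ) → ℕ
ΣFin f = sum (tabulate f)

-- Cartesian product G □ H, vertex (g , h) encoded as combine g h
_□_ : Graph → Graph → Graph
G □ H = record
  { n   = n G * n H
  ; _~_ = λ x y →
      let gh  = remQuot {n G} (n H) x
          gh' = remQuot {n G} (n H) y
      in (proj₁ gh ≡ proj₁ gh' × _~_ H (proj₂ gh) (proj₂ gh'))
       ⊎ (proj₂ gh ≡ proj₂ gh' × _~_ G (proj₁ gh) (proj₁ gh'))
  }

Config : Graph → Set
Config X = Fin (n X) → ℕ

size : ∀ {X} → Config X → ℕ
size c = ΣFin c

moveCfg : ∀ {X} → Config X → Fin (n X) → Fin (n X) → Config X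
moveCfg c u v w with w ≟ u
... | yes _ = c w ∸ 2
... | no _ with w ≟ v
...   | yes _ = suc (c w)
...   | no _  = c w

data Step (X : Graph) (c : Config X) : Config X → Set where
  move : ∀ u v → _~_ X u v → 2 ≤ c u → Step X c (moveCfg {X} c u v)

Solvable : (X : Graph) → Config X → Fin (n X) → Set
Solvable X c r = Σ (Config X) λ c' → Star (Step X) c c' × 1 ≤ c' r

AllSolvable : Graph → ℕ → Set
AllSolvable X k = ∀ (c : Config X) → size {X} c ≡ k → ∀ r → Solvable X c r

IsPebblingNumber : Graph → ℕ → Set
IsPebblingNumber X k = AllSolvable X k × (∀ m → AllSolvable X m → k ≤ m)

-- total floor division (a div 0 = 0; never used with 0 divisor for nonempty graphs)
_div_ : ℕ → ℕ → ℕ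
a div zero  = 0
a div suc b = a / suc b

-- which factor plays the role of K
data Side : Set where
  sideG sideH : Side

-- total K-set count  Σ_{j ∈ V(K̄)} ⌊ c̃_{K,j} / π(K) ⌋
-- (πG, πH are the pebbling numbers of G and H)
KSetCount : (G H : Graph) (πG πH : ℕ) → Side → Config (G □ H) → ℕ
KSetCount G H πG πH sideG c =
  ΣFin {n H} (λ j → (ΣFin {n G} (λ i → c (combine i j))) div πG)
KSetCount G H πG πH sideH c =
  ΣFin {n G} (λ j → (ΣFin {n H} (λ h → c (combine j h))) div πH)

πOther : (πG πH : ℕ) → Side → ℕ
πOther πG πH sideG = πH
πOther πG πH sideH = πG

-- Fix the K-coordinate x of the root. Inside each K-slice K_j, every π(K) pebbles can be
-- turned into one pebble on (x , j), so the slice yields set_{K,j} pebbles there; the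
-- slices are disjoint, so they can be treated one after another without disturbing each
-- other. The K̄-slice through x then holds at least π(K̄) pebbles, enough to reach the root.
-- Both steps rest on one principle: moves in an embedded copy of a graph can be replayed in
-- the big graph, and pebbles not involved in them stay where they are.
module Submission where

open import Defs
open import Data.Nat using (ℕ; _≥_; zero; suc; _+_; _*_; _∸_; _⊓_; _≤_; z≤n; s≤s)
open import Data.Nat.Properties hiding (_≟_)
open import Data.Nat.DivMod using (m/n*n≤m)
open import Data.Fin as Fin using (Fin; _≟_; remQuot; combine)
open import Data.Fin.Properties using (remQuot-combine; combine-remQuot; combine-injectiveˡ; combine-injectiveʳ)
open import Data.List using (List; []; _∷_; allFin)
open import Data.List.Membership.Propositional using (_∈_; _∉_)
open import Data.List.Membership.Propositional.Properties using (∈-allFin)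
open import Data.List.Relation.Unary.Any using (here; there)
open import Data.List.Relation.Unary.All using (lookup)
open import Data.List.Relation.Unary.All.Properties using (All¬⇒¬Any)
open import Data.List.Relation.Unary.Unique.Propositional using (Unique; []; _∷_)
open import Data.List.Relation.Unary.Unique.Propositional.Properties using (allFin⁺)
open import Data.Product using (∃; ∃₂; _×_; _,_; proj₁; proj₂)
open import Data.Sum using (_⊎_; inj₁; inj₂)
open import Data.Empty using (⊥-elim)
open import Relation.Nullary using (¬_; Dec; yes; no)
open import Relation.Binary.PropositionalEquality
open import Relation.Binary.Construct.Closure.ReflexiveTransitive using (Star; ε; _◅_; _◅◅_)
open import Algebra.Properties.CommutativeSemigroup +-commutativeSemigroup using (interchange)

module _ {X : Graph} (c : Config X) {u v w : Fin (n X)} where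

  moveCfg-source : w ≡ u → moveCfg {X} c u v w ≡ c w ∸ 2
  moveCfg-source w≡u with w ≟ u
  ... | yes _   = refl
  ... | no w≢u = ⊥-elim (w≢u w≡u)

  moveCfg-target : ¬ w ≡ u → w ≡ v → moveCfg {X} c u v w ≡ suc (c w)
  moveCfg-target w≢u w≡v with w ≟ u
  ... | yes w≡u = ⊥-elim (w≢u w≡u)
  ... | no _ with w ≟ v
  ...   | yes _   = refl
  ...   | no w≢v = ⊥-elim (w≢v w≡v)

  moveCfg-other : ¬ w ≡ u → ¬ w ≡ v → moveCfg {X} c u v w ≡ c w
  moveCfg-other w≢u w≢v with w ≟ u
  ... | yes w≡u = ⊥-elim (w≢u w≡u)
  ... | no _ with w ≟ v
  ...   | yes w≡v = ⊥-elim (w≢v w≡v)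
  ...   | no _    = refl

ΣFin-mono : ∀ {k} {f g : Fin k → ℕ} → (∀ x → f x ≤ g x) → ΣFin f ≤ ΣFin g
ΣFin-mono {zero}  f≤g = z≤n
ΣFin-mono {suc k} f≤g = +-mono-≤ (f≤g Fin.zero) (ΣFin-mono (λ x → f≤g (Fin.suc x)))

ΣFin-cong : ∀ {k} {f g : Fin k → ℕ} → (∀ x → f x ≡ g x) → ΣFin f ≡ ΣFin g
ΣFin-cong {zero}  f≡g = refl
ΣFin-cong {suc k} f≡g = cong₂ _+_ (f≡g Fin.zero) (ΣFin-cong (λ x → f≡g (Fin.suc x)))

ΣFin-+ : ∀ {k} (f g : Fin k → ℕ) → ΣFin (λ x → f x + g x) ≡ ΣFin f + ΣFin g
ΣFin-+ {zero}  f g = refl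
ΣFin-+ {suc k} f g = begin
  f Fin.zero + g Fin.zero + ΣFin (λ x → f (Fin.suc x) + g (Fin.suc x))
    ≡⟨ cong (f Fin.zero + g Fin.zero +_) (ΣFin-+ (λ x → f (Fin.suc x)) (λ x → g (Fin.suc x))) ⟩
  f Fin.zero + g Fin.zero + (ΣFin (λ x → f (Fin.suc x)) + ΣFin (λ x → g (Fin.suc x)))
    ≡⟨ interchange (f Fin.zero) (g Fin.zero) (ΣFin (λ x → f (Fin.suc x))) (ΣFin (λ x → g (Fin.suc x))) ⟩
  ΣFin f + ΣFin g ∎
  where open ≡-Reasoning

ΣFin-split : ∀ {k} {f g h : Fin k → ℕ} {m} → (∀ x → f x + g x ≡ h x) → ΣFin f ≡ m → ΣFin h ≡ m + ΣFin g
ΣFin-split {g = g} f+g≡h |f|≡m = trans (sym (ΣFin-cong f+g≡h)) (trans (ΣFin-+ _ g) (cong (_+ ΣFin g) |f|≡m))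

split-config : ∀ {k} (a : Fin k → ℕ) m → m ≤ ΣFin a →
               ∃₂ λ (b b' : Fin k → ℕ) → ΣFin b ≡ m × (∀ x → b x + b' x ≡ a x)
split-config {zero}  a m m≤0 = a , a , sym (n≤0⇒n≡0 m≤0) , λ ()
split-config {suc k} a m m≤|a|
  with b , b' , |b|≡m∸a₀ , b+b'≡a ← split-config (λ x → a (Fin.suc x)) (m ∸ a Fin.zero) (m≤n+o⇒m∸n≤o m (a Fin.zero) m≤|a|)
  = (λ { Fin.zero → a₀ ⊓ m ; (Fin.suc x) → b x })
  , (λ { Fin.zero → a₀ ∸ m ; (Fin.suc x) → b' x })
  , trans (cong (a₀ ⊓ m +_) |b|≡m∸a₀) (m⊓n+n∸m≡n a₀ m)
  , λ { Fin.zero → trans (cong (_+ (a₀ ∸ m)) (⊓-comm a₀ m)) (m⊓n+n∸m≡n m a₀) ; (Fin.suc x) → b+b'≡a x }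
  where
  a₀ : ℕ
  a₀ = a Fin.zero

record Embedding (X Y : Graph) : Set where
  field
    to          : Fin (n X) → Fin (n Y)
    homomorphic : ∀ {u v} → _~_ X u v → _~_ Y (to u) (to v)
    injective   : ∀ {u v} → to u ≡ to v → u ≡ v

id-embedding : ∀ X → Embedding X X
id-embedding X = record { to = λ x → x ; homomorphic = λ u~v → u~v ; injective = λ eq → eq }

module _ {X Y : Graph} (E : Embedding X Y) where
  open Embedding E

  -- d holds the reserve e together with a copy of a placed along E.
  Covers : Config Y → Config X → Config Y → Set
  Covers e a d = (∀ x → e (to x) + a x ≤ d (to x)) × (∀ y → e y ≤ d y)

  simulate-step : ∀ {e a a' d} → Step X a a' → Covers e a d →
                  ∃ λ d' → Step Y d d' × Covers e a' d'
  simulate-step {e} {a} {d = d} (move u v u~v 2≤au) (above , reserve) =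
    moveCfg {Y} d (to u) (to v) , move (to u) (to v) (homomorphic u~v) 2≤du , above' , reserve'
    where
    2≤du : 2 ≤ d (to u)
    2≤du = ≤-trans 2≤au (≤-trans (m≤n+m (a u) (e (to u))) (above u))

    source-bound : e (to u) + (a u ∸ 2) ≤ d (to u) ∸ 2
    source-bound = subst (_≤ d (to u) ∸ 2) (+-∸-assoc (e (to u)) 2≤au) (∸-monoˡ-≤ 2 (above u))

    above' : ∀ x → e (to x) + moveCfg {X} a u v x ≤ moveCfg {Y} d (to u) (to v) (to x)
    above' x = above-by-cases x (x ≟ u) (x ≟ v)
      where
      above-by-cases : ∀ x → Dec (x ≡ u) → Dec (x ≡ v) →
                       e (to x) + moveCfg {X} a u v x ≤ moveCfg {Y} d (to u) (to v) (to x)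
      above-by-cases x (yes refl) _
        rewrite moveCfg-source {X} a {x} {v} {x} refl
              | moveCfg-source {Y} d {to x} {to v} {to x} refl = source-bound
      above-by-cases x (no x≢u) (yes refl)
        rewrite moveCfg-target {X} a {u} {x} {x} x≢u refl
              | moveCfg-target {Y} d {to u} {to x} {to x} (λ eq → x≢u (injective eq)) refl
              = subst (_≤ suc (d (to x))) (sym (+-suc (e (to x)) (a x))) (s≤s (above x))
      above-by-cases x (no x≢u) (no x≢v)
        rewrite moveCfg-other {X} a {u} {v} {x} x≢u x≢v
              | moveCfg-other {Y} d {to u} {to v} {to x} (λ eq → x≢u (injective eq)) (λ eq → x≢v (injective eq))
              = above x

    reserve' : ∀ y → e y ≤ moveCfg {Y} d (to u) (to v) y
    reserve' y = reserve-by-cases y (y ≟ to u) (y ≟ to v)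
      where
      reserve-by-cases : ∀ y → Dec (y ≡ to u) → Dec (y ≡ to v) → e y ≤ moveCfg {Y} d (to u) (to v) y
      reserve-by-cases y (yes refl) _
        rewrite moveCfg-source {Y} d {y} {to v} {y} refl = ≤-trans (m≤m+n _ _) source-bound
      reserve-by-cases y (no y≢u) (yes refl)
        rewrite moveCfg-target {Y} d {to u} {y} {y} y≢u refl = m≤n⇒m≤1+n (reserve y)
      reserve-by-cases y (no y≢u) (no y≢v)
        rewrite moveCfg-other {Y} d {to u} {to v} {y} y≢u y≢v = reserve y

  simulate : ∀ {e a a' d} → Star (Step X) a a' → Covers e a d →
             ∃ λ d' → Star (Step Y) d d' × Covers e a' d'
  simulate ε covers = _ , ε , covers
  simulate (s ◅ ss) covers
    with d₁ , s′ , covers₁ ← simulate-step s covers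
    with d₂ , ss′ , covers₂ ← simulate ss covers₁
    = d₂ , s′ ◅ ss′ , covers₂

superpose : ∀ {X} {a₁ b₁ a₂ b₂ d : Config X} →
            Star (Step X) a₁ b₁ → Star (Step X) a₂ b₂ → (∀ x → a₁ x + a₂ x ≤ d x) →
            ∃ λ d' → Star (Step X) d d' × (∀ x → b₁ x + b₂ x ≤ d' x)
superpose {X} {a₁} {b₁} {a₂} {d = d} a₁→b₁ a₂→b₂ a₁+a₂≤d
  with d₁ , d→d₁ , above₁ , _ ← simulate (id-embedding X) {e = a₂} a₁→b₁
         ( (λ x → subst (_≤ d x) (+-comm (a₁ x) (a₂ x)) (a₁+a₂≤d x))
         , (λ x → ≤-trans (m≤n+m (a₂ x) (a₁ x)) (a₁+a₂≤d x)))
  with d₂ , d₁→d₂ , above₂ , _ ← simulate (id-embedding X) {e = b₁} a₂→b₂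
         ( (λ x → subst (_≤ d₁ x) (+-comm (a₂ x) (b₁ x)) (above₁ x))
         , (λ x → ≤-trans (m≤n+m (b₁ x) (a₂ x)) (above₁ x)))
  = d₂ , d→d₁ ◅◅ d₁→d₂ , above₂

gather-pebbles : ∀ {X π} → AllSolvable X π → ∀ t (a : Config X) → t * π ≤ size {X} a → ∀ r →
                 ∃ λ a' → Star (Step X) a a' × t ≤ a' r
gather-pebbles solve zero a _ r = a , ε , z≤n
gather-pebbles {π = π} solve (suc t) a π+t·π≤|a| r
  with b , rest , |b|≡π , b+rest≡a ← split-config a π (≤-trans (m≤m+n π (t * π)) π+t·π≤|a|)
  with b' , b→b' , 1≤b'r ← solve b |b|≡π r
  with a' , rest→a' , t≤a'r ← gather-pebbles solve t rest
         (+-cancelˡ-≤ π _ _ (subst (π + t * π ≤_) (ΣFin-split b+rest≡a |b|≡π) π+t·π≤|a|)) r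
  with d , a→d , above ← superpose b→b' rest→a' (λ x → ≤-reflexive (b+rest≡a x))
  = d , a→d , ≤-trans (+-mono-≤ 1≤b'r t≤a'r) (above r)

div-*-≤ : ∀ s π → (s div π) * π ≤ s
div-*-≤ s zero    = z≤n
div-*-≤ s (suc π) = m/n*n≤m s (suc π)

record Grid (X Z Y : Graph) : Set where
  field
    point            : Fin (n X) → Fin (n Z) → Fin (n Y)
    sliceOf          : Fin (n Y) → Fin (n Z)
    sliceOf-point    : ∀ i j → sliceOf (point i j) ≡ j
    point-injectiveˡ : ∀ {i i' j} → point i j ≡ point i' j → i ≡ i'
    point-surjective : ∀ y → ∃₂ λ i j → point i j ≡ y
    slice-adj        : ∀ {i i'} j → _~_ X i i' → _~_ Y (point i j) (point i' j)
    fibre-adj        : ∀ i {j j'} → _~_ Z j j' → _~_ Y (point i j) (point i j')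

module _ {X Z Y : Graph} (grid : Grid X Z Y) where
  open Grid grid

  slice : Fin (n Z) → Embedding X Y
  slice j = record { to = λ i → point i j ; homomorphic = slice-adj j ; injective = point-injectiveˡ }

  fibre : Fin (n X) → Embedding Z Y
  fibre i = record
    { to          = point i
    ; homomorphic = fibre-adj i
    ; injective   = λ {j} {j'} eq → trans (sym (sliceOf-point i j)) (trans (cong sliceOf eq) (sliceOf-point i j'))
    }

  sliceSize : Config Y → Fin (n Z) → ℕ
  sliceSize d j = ΣFin (λ i → d (point i j))

  clearSlice : Fin (n Z) → Config Y → Config Y
  clearSlice j d y with sliceOf y ≟ j
  ... | yes _ = 0
  ... | no _  = d y

  clearSlice-≤ : ∀ j d y → clearSlice j d y ≤ d y
  clearSlice-≤ j d y with sliceOf y ≟ j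
  ... | yes _ = z≤n
  ... | no _  = ≤-refl

  clearSlice-point : ∀ j d i → clearSlice j d (point i j) ≡ 0
  clearSlice-point j d i with sliceOf (point i j) ≟ j
  ... | yes _  = refl
  ... | no ≢j = ⊥-elim (≢j (sliceOf-point i j))

  clearSlice-off : ∀ j d y → ¬ sliceOf y ≡ j → clearSlice j d y ≡ d y
  clearSlice-off j d y ≢j with sliceOf y ≟ j
  ... | yes ≡j = ⊥-elim (≢j ≡j)
  ... | no _   = refl

  point-off-slice : ∀ {i j j'} → ¬ j' ≡ j → ¬ sliceOf (point i j') ≡ j
  point-off-slice {i} {j' = j'} j'≢j eq = j'≢j (trans (sym (sliceOf-point i j')) eq)

  gather-in-slice : ∀ {π} → AllSolvable X π → ∀ j t (d : Config Y) → t * π ≤ sliceSize d j → ∀ i →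
                    ∃ λ d' → Star (Step Y) d d' × (∀ y → ¬ sliceOf y ≡ j → d y ≤ d' y) × t ≤ d' (point i j)
  gather-in-slice solve j t d t·π≤ i
    with a' , a→a' , t≤a'i ← gather-pebbles solve t (λ i' → d (point i' j)) t·π≤ i
    with d' , d→d' , above , reserve ← simulate (slice j) {e = clearSlice j d} a→a'
           ((λ i' → ≤-reflexive (cong (_+ d (point i' j)) (clearSlice-point j d i'))) , clearSlice-≤ j d)
    = d' , d→d' , (λ y ≢j → subst (_≤ d' y) (clearSlice-off j d y ≢j) (reserve y))
    , ≤-trans t≤a'i (≤-trans (m≤n+m _ _) (above i))

  gather-in-slices : ∀ {π} → AllSolvable X π → (t : Fin (n Z) → ℕ) (i : Fin (n X)) →
                     (js : List (Fin (n Z))) → Unique js → (d : Config Y) →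
                     (∀ {j} → j ∈ js → t j * π ≤ sliceSize d j) →
                     ∃ λ d' → Star (Step Y) d d' × (∀ y → sliceOf y ∉ js → d y ≤ d' y)
                            × (∀ {j} → j ∈ js → t j ≤ d' (point i j))
  gather-in-slices solve t i [] _ d _ = d , ε , (λ _ _ → ≤-refl) , λ ()
  gather-in-slices solve t i (j ∷ js) (j∉js ∷ unique) d enough
    with d₁ , d→d₁ , kept₁ , t≤d₁ ← gather-in-slice solve j (t j) d (enough (here refl)) i
    with d₂ , d₁→d₂ , kept₂ , t≤d₂ ← gather-in-slices solve t i js unique d₁
           (λ j'∈js → ≤-trans (enough (there j'∈js))
                        (ΣFin-mono (λ i' → kept₁ _ (point-off-slice {i'} (≢-sym (lookup j∉js j'∈js))))))
    = d₂ , d→d₁ ◅◅ d₁→d₂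
    , (λ y ∉j∷js → ≤-trans (kept₁ y (λ eq → ∉j∷js (here eq))) (kept₂ y (λ ∈js → ∉j∷js (there ∈js))))
    , λ { (here refl) → ≤-trans t≤d₁ (kept₂ _ (subst (_∉ js) (sym (sliceOf-point i j)) (All¬⇒¬Any j∉js)))
        ; (there j'∈js) → t≤d₂ j'∈js }

  grid-solvable : ∀ {πX πZ} → AllSolvable X πX → AllSolvable Z πZ → (c : Config Y) →
                  πZ ≤ ΣFin (λ j → sliceSize c j div πX) → ∀ r → Solvable Y c r
  grid-solvable {πX} {πZ} solveX solveZ c πZ≤sets r
    with i , z , refl ← point-surjective r
    with d , c→d , _ , sets≤d ← gather-in-slices solveX (λ j → sliceSize c j div πX) i
           (allFin (n Z)) (allFin⁺ (n Z)) c (λ {j} _ → div-*-≤ (sliceSize c j) πX)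
    with a' , a→a' , 1≤a'z ← gather-pebbles solveZ 1 (λ j → d (point i j))
           (≤-trans (≤-reflexive (*-identityˡ πZ)) (≤-trans πZ≤sets (ΣFin-mono (λ j → sets≤d (∈-allFin j))))) z
    with d' , d→d' , above , _ ← simulate (fibre i) {e = λ _ → 0} a→a' ((λ _ → ≤-refl) , λ _ → z≤n)
    = d' , c→d ◅◅ d→d' , ≤-trans 1≤a'z (above z)

module _ (G H : Graph) where

  private
    ProductAdj : Fin (n G) × Fin (n H) → Fin (n G) × Fin (n H) → Set
    ProductAdj p q = (proj₁ p ≡ proj₁ q × _~_ H (proj₂ p) (proj₂ q))
                   ⊎ (proj₂ p ≡ proj₂ q × _~_ G (proj₁ p) (proj₁ q))

    □-adj : ∀ {i i' j j'} → ProductAdj (i , j) (i' , j') → _~_ (G □ H) (combine i j) (combine i' j')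
    □-adj {i} {i'} {j} {j'} = subst₂ ProductAdj (sym (remQuot-combine i j)) (sym (remQuot-combine i' j'))

  □-G-slices : Grid G H (G □ H)
  □-G-slices = record
    { point            = combine
    ; sliceOf          = λ y → proj₂ (remQuot {n G} (n H) y)
    ; sliceOf-point    = λ i j → cong proj₂ (remQuot-combine i j)
    ; point-injectiveˡ = λ {i} {i'} {j} → combine-injectiveˡ i j i' j
    ; point-surjective = λ y → _ , _ , combine-remQuot {n G} (n H) y
    ; slice-adj        = λ j g~g' → □-adj (inj₂ (refl , g~g'))
    ; fibre-adj        = λ i h~h' → □-adj (inj₁ (refl , h~h'))
    }

  □-H-slices : Grid H G (G □ H)
  □-H-slices = record
    { point            = λ h g → combine g h
    ; sliceOf          = λ y → proj₁ (remQuot {n G} (n H) y)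
    ; sliceOf-point    = λ h g → cong proj₁ (remQuot-combine g h)
    ; point-injectiveˡ = λ {h} {h'} {g} → combine-injectiveʳ g h g h'
    ; point-surjective = λ y → _ , _ , combine-remQuot {n G} (n H) y
    ; slice-adj        = λ g h~h' → □-adj (inj₁ (refl , h~h'))
    ; fibre-adj        = λ h g~g' → □-adj (inj₂ (refl , g~g'))
    }

lemma1 : (G H : Graph) → Simple G → Simple H → Connected G → Connected H →
    (πG πH : ℕ) → IsPebblingNumber G πG → IsPebblingNumber H πH →
    (K : Side) → (c : Config (G □ H)) →
    KSetCount G H πG πH K c ≥ πOther πG πH K →
    (r : Fin (n (G □ H))) → Solvable (G □ H) c r
lemma1 G H _ _ _ _ πG πH (solveG , _) (solveH , _) sideG c enough =
  grid-solvable (□-G-slices G H) solveG solveH c enough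
lemma1 G H _ _ _ _ πG πH (solveG , _) (solveH , _) sideH c enough =
  grid-solvable (□-H-slices G H) solveH solveG c enough
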